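{- Let $G=(V,E)$ be a finite simple graph and let $d$ be a nonnegative integer. Then the number $P_d$ of parity-closed walks of length $d$ in $G$ satisfies $$P_d=2^{ -|E|}\sum_{\pi\in\Pi}\mathrm{S}_d(G_\pi).$$
   Context: A sign function on $G$ is a map $\pi:E\to\{\pm1\}$, and $\Pi$ is the set of all sign functions on $E$. The signed graph $G_\pi$ has signed adjacency matrix $A(G_\pi)$ whose $(u,v)$ entry is $\pi(\{u,v\})$ if $\{u,v\}\in E$ and $0$ otherwise; $\mathrm{S}_d(G_\pi)=\mathrm{trace}(A(G_\pi)^d)$ is its $d$-th spectral moment. A closed walk of length $d$ is a sequence of vertices $(v_0,\ldots,v_d)$ with $v_d=v_0$ and $\{v_{t-1},v_t\}\in E$ for all $t$; it uses an edge $e$ as many times as there are indices $t$ with $\{v_{t-1},v_t\}=e$. A closed walk is parity-closed if it uses every edge of $G$ an even number of times (possibly zero). -}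

module Defs where

open import Data.Nat using (ℕ; zero; suc; _<ᵇ_; _%_)
open import Data.Bool using (Bool; true; false; if_then_else_; _∧_; _∨_; not)
open import Data.Fin using (Fin; toℕ; fromℕ; inject₁) renaming (zero to fz; suc to fs)
open import Data.Fin.Properties using (_≟_)
open import Data.Integer using (ℤ; +_; -_; 0ℤ; 1ℤ)
import Data.Integer as ℤ
open import Data.List using (List; []; _∷_; allFin; filter; length; map; concatMap; foldr)
open import Data.Vec using (Vec; []; _∷_; lookup; head)
open import Data.Product using (_×_; _,_; proj₁; proj₂)
open import Relation.Nullary.Decidable using (⌊_⌋)
open import Relation.Binary.PropositionalEquality using (_≡_)

record SimpleGraph (n : ℕ) : Set where
  field
    adj      : Fin n → Fin n → Bool
    adj-sym  : ∀ u v → adj u v ≡ adj v u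
    adj-irr  : ∀ u → adj u u ≡ false
open SimpleGraph public

∑ℤ : (k : ℕ) → (Fin k → ℤ) → ℤ
∑ℤ zero    f = 0ℤ
∑ℤ (suc k) f = f fz ℤ.+ ∑ℤ k (λ i → f (fs i))

∑ℕ : (k : ℕ) → (Fin k → ℕ) → ℕ
∑ℕ zero    f = 0
∑ℕ (suc k) f = f fz Data.Nat.+ ∑ℕ k (λ i → f (fs i))

sumℤ : List ℤ → ℤ
sumℤ = foldr ℤ._+_ 0ℤ

allB : ∀ {A : Set} → (A → Bool) → List A → Bool
allB p []       = true
allB p (x ∷ xs) = p x ∧ allB p xs

_==_ : ∀ {n} → Fin n → Fin n → Bool
u == v = ⌊ u ≟ v ⌋

-- The edge set E: each edge {u,v} listed exactly once, as the pair (u,v)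
-- with u < v.
edges : ∀ {n} → SimpleGraph n → List (Fin n × Fin n)
edges {n} G =
  concatMap (λ u → map (λ v → (u , v))
                       (filter (λ v → Data.Bool.T? (adj G u v ∧ (toℕ u <ᵇ toℕ v))) (allFin n)))
            (allFin n)

numEdges : ∀ {n} → SimpleGraph n → ℕ
numEdges G = length (edges G)

edgeAt : ∀ {n} (G : SimpleGraph n) → Fin (numEdges G) → Fin n × Fin n
edgeAt G k = Data.List.lookup (edges G) k

sameEdge : ∀ {n} → Fin n × Fin n → Fin n → Fin n → Bool
sameEdge (x , y) u v = ((x == u) ∧ (y == v)) ∨ ((x == v) ∧ (y == u))

-- A sign function π : E → {±1}, indexed by the edges of G (true ↦ +1, false ↦ -1).
SignFunction : ∀ {n} → SimpleGraph n → Set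
SignFunction G = Vec Bool (numEdges G)

sign : Bool → ℤ
sign true  = 1ℤ
sign false = - 1ℤ

allVecs : ∀ {A : Set} → List A → (k : ℕ) → List (Vec A k)
allVecs xs zero    = [] ∷ []
allVecs xs (suc k) = concatMap (λ x → map (x ∷_) (allVecs xs k)) xs

allSignFunctions : ∀ {n} (G : SimpleGraph n) → List (SignFunction G)
allSignFunctions G = allVecs (true ∷ false ∷ []) (numEdges G)

Matrix : ℕ → Set
Matrix n = Fin n → Fin n → ℤ

-- Signed adjacency matrix A(G_π): entry π({u,v}) if {u,v} ∈ E, else 0.
signedAdj : ∀ {n} (G : SimpleGraph n) → SignFunction G → Matrix n
signedAdj G π u v =
  ∑ℤ (numEdges G) (λ k → if sameEdge (edgeAt G k) u v then sign (lookup π k) else 0ℤ)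

identity : ∀ {n} → Matrix n
identity u v = if u == v then 1ℤ else 0ℤ

_⊗_ : ∀ {n} → Matrix n → Matrix n → Matrix n
_⊗_ {n} A B u v = ∑ℤ n (λ w → A u w ℤ.* B w v)

_^ᴹ_ : ∀ {n} → Matrix n → ℕ → Matrix n
A ^ᴹ zero  = identity
A ^ᴹ suc d = A ⊗ (A ^ᴹ d)

trace : ∀ {n} → Matrix n → ℤ
trace {n} A = ∑ℤ n (λ u → A u u)

spectralMoment : ∀ {n} (G : SimpleGraph n) → SignFunction G → ℕ → ℤ
spectralMoment G π d = trace (signedAdj G π ^ᴹ d)

-- A candidate closed walk of length d: a vertex sequence (v_0,…,v_d).
-- Step t (t = 0,…,d-1) goes from v_t to v_{t+1}.
stepFrom stepTo : ∀ {n d} → Vec (Fin n) (suc d) → Fin d → Fin n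
stepFrom w t = lookup w (inject₁ t)
stepTo   w t = lookup w (fs t)

isClosedWalk : ∀ {n} (G : SimpleGraph n) (d : ℕ) → Vec (Fin n) (suc d) → Bool
isClosedWalk {n} G d w =
  (lookup w (fromℕ d) == head w) ∧ allB (λ t → adj G (stepFrom w t) (stepTo w t)) (allFin d)

usage : ∀ {n d} → Vec (Fin n) (suc d) → Fin n × Fin n → ℕ
usage {d = d} w e = ∑ℕ d (λ t → if sameEdge e (stepFrom w t) (stepTo w t) then 1 else 0)

isEven : ℕ → Bool
isEven m = ⌊ (m % 2) Data.Nat.≟ 0 ⌋

isParityClosed : ∀ {n} (G : SimpleGraph n) (d : ℕ) → Vec (Fin n) (suc d) → Bool
isParityClosed G d w = allB (λ e → isEven (usage w e)) (edges G)

parityClosedWalkCount : ∀ {n} (G : SimpleGraph n) → ℕ → ℕ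
parityClosedWalkCount {n} G d =
  length (filter (λ w → Data.Bool.T? (isClosedWalk G d w ∧ isParityClosed G d w))
                 (allVecs (allFin n) (suc d)))

-- Expanding the matrix power, S_d(G_π) = trace(A(G_π)^d) is the sum over closed walks w of
-- the product of the entries of A(G_π) along w. Each entry is π(e) for the unique edge
-- e = {u,v} (and 0 off the edges), so the product is ∏_e π(e)^(uses of e by w). Summing
-- over all π, the distributive law splits the sum edge by edge, and 1^k + (-1)^k is 2 for
-- even k and 0 for odd k: a parity-closed walk contributes 2^|E|, every other walk 0.
module Submission where

open import Defs
open import Data.Nat using (ℕ; zero; suc; _^_; _<ᵇ_)
import Data.Nat.Properties as ℕP
open import Data.Integer using (ℤ; +_; -_; _+_; _*_; 0ℤ; 1ℤ) renaming (_^_ to _^ℤ_)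
import Data.Integer.Properties as ℤP
open import Data.Bool using (Bool; true; false; if_then_else_; _∧_; _∨_; T?)
open import Data.Bool.Properties using (∨-idem; ∧-zeroʳ)
open import Data.Fin using (Fin; toℕ; fromℕ) renaming (zero to fz; suc to fs)
open import Data.Fin.Properties using (_≟_; toℕ-injective)
open import Data.List as List
  using (List; []; _∷_; _++_; map; concatMap; filter; tabulate; allFin; length)
import Data.List.Properties as Listₚ
open import Data.Vec using (Vec; _∷_; lookup; head)
open import Data.Product using (_×_; _,_)
open import Data.Empty using (⊥-elim)
open import Function using (_∘_; id)
open import Relation.Nullary using (yes; no)
open import Relation.Binary.PropositionalEquality
open import Algebra.Properties.CommutativeMonoid.Sum ℤP.*-1-commutativeMonoid as Product
  using ()
  renaming (sum-cong-≗ to ∏-cong; ∑-distrib-+ to ∏-distrib-*; ∑-comm to ∏-comm)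
open import Algebra.Properties.CommutativeSemigroup ℤP.+-commutativeSemigroup
  using () renaming (interchange to +-interchange)
open import Algebra.Properties.CommutativeSemigroup ℤP.*-commutativeSemigroup
  using () renaming (x∙yz≈y∙xz to x*yz≡y*xz; x∙yz≈z∙yx to x*yz≡z*yx)

open ≡-Reasoning

𝟙 : Bool → ℤ
𝟙 b = + (if b then 1 else 0)

count : (k : ℕ) → (Fin k → Bool) → ℕ
count k c = ∑ℕ k (λ i → if c i then 1 else 0)

∏ : (k : ℕ) → (Fin k → ℤ) → ℤ
∏ k = Product.sum {k}

𝟙-∧ : ∀ a b → 𝟙 (a ∧ b) ≡ 𝟙 a * 𝟙 b
𝟙-∧ true  b = sym (ℤP.*-identityˡ (𝟙 b))
𝟙-∧ false b = refl

𝟙-∧-∨-disjoint : ∀ a b c → b ∧ c ≡ false → 𝟙 a * 𝟙 (b ∨ c) ≡ 𝟙 (a ∧ b) + 𝟙 (a ∧ c)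
𝟙-∧-∨-disjoint false b     c     _  = refl
𝟙-∧-∨-disjoint true  true  true  ()
𝟙-∧-∨-disjoint true  true  false _  = refl
𝟙-∧-∨-disjoint true  false true  _  = refl
𝟙-∧-∨-disjoint true  false false _  = refl

𝟙<ᵇ+𝟙>ᵇ≡1 : ∀ {m n} → m ≢ n → 𝟙 (m <ᵇ n) + 𝟙 (n <ᵇ m) ≡ 1ℤ
𝟙<ᵇ+𝟙>ᵇ≡1 {zero}  {zero}  m≢n = ⊥-elim (m≢n refl)
𝟙<ᵇ+𝟙>ᵇ≡1 {zero}  {suc n} _   = refl
𝟙<ᵇ+𝟙>ᵇ≡1 {suc m} {zero}  _   = refl
𝟙<ᵇ+𝟙>ᵇ≡1 {suc m} {suc n} m≢n = 𝟙<ᵇ+𝟙>ᵇ≡1 (m≢n ∘ cong suc)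

sumℤ-++ : (xs ys : List ℤ) → sumℤ (xs ++ ys) ≡ sumℤ xs + sumℤ ys
sumℤ-++ []       ys = sym (ℤP.+-identityˡ (sumℤ ys))
sumℤ-++ (x ∷ xs) ys = trans (cong (_+_ x) (sumℤ-++ xs ys)) (sym (ℤP.+-assoc x _ _))

module _ {A : Set} where

  sumℤ-map-cong : ∀ {f g : A → ℤ} → (∀ x → f x ≡ g x) → ∀ xs →
    sumℤ (map f xs) ≡ sumℤ (map g xs)
  sumℤ-map-cong f≗g xs = cong sumℤ (Listₚ.map-cong f≗g xs)

  sumℤ-map-0 : ∀ (xs : List A) → sumℤ (map (λ _ → 0ℤ) xs) ≡ 0ℤ
  sumℤ-map-0 []       = refl
  sumℤ-map-0 (x ∷ xs) = trans (ℤP.+-identityˡ _) (sumℤ-map-0 xs)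

  sumℤ-map-+ : ∀ (f g : A → ℤ) xs →
    sumℤ (map (λ x → f x + g x) xs) ≡ sumℤ (map f xs) + sumℤ (map g xs)
  sumℤ-map-+ f g []       = refl
  sumℤ-map-+ f g (x ∷ xs) =
    trans (cong (_+_ (f x + g x)) (sumℤ-map-+ f g xs)) (+-interchange (f x) (g x) _ _)

  sumℤ-map-*ˡ : ∀ c (f : A → ℤ) xs → sumℤ (map (λ x → c * f x) xs) ≡ c * sumℤ (map f xs)
  sumℤ-map-*ˡ c f []       = sym (ℤP.*-zeroʳ c)
  sumℤ-map-*ˡ c f (x ∷ xs) =
    trans (cong (_+_ (c * f x)) (sumℤ-map-*ˡ c f xs)) (sym (ℤP.*-distribˡ-+ c (f x) _))

  sumℤ-map-*ʳ : ∀ c (f : A → ℤ) xs → sumℤ (map (λ x → f x * c) xs) ≡ sumℤ (map f xs) * c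
  sumℤ-map-*ʳ c f []       = refl
  sumℤ-map-*ʳ c f (x ∷ xs) =
    trans (cong (_+_ (f x * c)) (sumℤ-map-*ʳ c f xs)) (sym (ℤP.*-distribʳ-+ c (f x) _))

  sumℤ-map-filter : ∀ (p : A → Bool) (f : A → ℤ) xs →
    sumℤ (map f (filter (T? ∘ p) xs)) ≡ sumℤ (map (λ x → 𝟙 (p x) * f x) xs)
  sumℤ-map-filter p f []       = refl
  sumℤ-map-filter p f (x ∷ xs) with p x
  ... | true  = cong₂ _+_ (sym (ℤP.*-identityˡ (f x))) (sumℤ-map-filter p f xs)
  ... | false = trans (sumℤ-map-filter p f xs) (sym (ℤP.+-identityˡ _))

  +length-filter : ∀ (p : A → Bool) xs →
    + length (filter (T? ∘ p) xs) ≡ sumℤ (map (𝟙 ∘ p) xs)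
  +length-filter p []       = refl
  +length-filter p (x ∷ xs) with p x
  ... | true  = cong (_+_ 1ℤ) (+length-filter p xs)
  ... | false = trans (+length-filter p xs) (sym (ℤP.+-identityˡ _))

  ∑ℤ-tabulate : ∀ n (f : A → ℤ) (g : Fin n → A) →
    ∑ℤ n (f ∘ g) ≡ sumℤ (map f (tabulate g))
  ∑ℤ-tabulate zero    f g = refl
  ∑ℤ-tabulate (suc n) f g = cong (_+_ (f (g fz))) (∑ℤ-tabulate n f (g ∘ fs))

  ∑ℤ-lookup : ∀ (f : A → ℤ) xs → ∑ℤ (length xs) (f ∘ List.lookup xs) ≡ sumℤ (map f xs)
  ∑ℤ-lookup f []       = refl
  ∑ℤ-lookup f (x ∷ xs) = cong (_+_ (f x)) (∑ℤ-lookup f xs)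

  𝟙-allB-tabulate : ∀ d (p : A → Bool) (g : Fin d → A) →
    𝟙 (allB p (tabulate g)) ≡ ∏ d (𝟙 ∘ p ∘ g)
  𝟙-allB-tabulate zero    p g = refl
  𝟙-allB-tabulate (suc d) p g =
    trans (𝟙-∧ (p (g fz)) _) (cong (𝟙 (p (g fz)) *_) (𝟙-allB-tabulate d p (g ∘ fs)))

  𝟙-allB-lookup : ∀ (p : A → Bool) xs →
    𝟙 (allB p xs) ≡ ∏ (length xs) (𝟙 ∘ p ∘ List.lookup xs)
  𝟙-allB-lookup p []       = refl
  𝟙-allB-lookup p (x ∷ xs) = trans (𝟙-∧ (p x) _) (cong (𝟙 (p x) *_) (𝟙-allB-lookup p xs))

module _ {A B : Set} where

  sumℤ-map-concatMap : ∀ (f : B → ℤ) (g : A → List B) xs →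
    sumℤ (map f (concatMap g xs)) ≡ sumℤ (map (λ x → sumℤ (map f (g x))) xs)
  sumℤ-map-concatMap f g []       = refl
  sumℤ-map-concatMap f g (x ∷ xs) = begin
    sumℤ (map f (g x ++ concatMap g xs))
      ≡⟨ cong sumℤ (Listₚ.map-++ f (g x) _) ⟩
    sumℤ (map f (g x) ++ map f (concatMap g xs))
      ≡⟨ sumℤ-++ (map f (g x)) _ ⟩
    sumℤ (map f (g x)) + sumℤ (map f (concatMap g xs))
      ≡⟨ cong (_+_ (sumℤ (map f (g x)))) (sumℤ-map-concatMap f g xs) ⟩
    sumℤ (map f (g x)) + sumℤ (map (λ x → sumℤ (map f (g x))) xs) ∎

  sumℤ-map-comm : ∀ (f : A → B → ℤ) xs ys →
    sumℤ (map (λ x → sumℤ (map (f x) ys)) xs)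
      ≡ sumℤ (map (λ y → sumℤ (map (λ x → f x y) xs)) ys)
  sumℤ-map-comm f []       ys = sym (sumℤ-map-0 ys)
  sumℤ-map-comm f (x ∷ xs) ys =
    trans (cong (_+_ (sumℤ (map (f x) ys))) (sumℤ-map-comm f xs ys))
          (sym (sumℤ-map-+ (f x) _ ys))

sumℤ-allVecs-suc : ∀ {A : Set} (xs : List A) k (F : Vec A (suc k) → ℤ) →
  sumℤ (map F (allVecs xs (suc k)))
    ≡ sumℤ (map (λ x → sumℤ (map (F ∘ (x ∷_)) (allVecs xs k))) xs)
sumℤ-allVecs-suc xs k F =
  trans (sumℤ-map-concatMap F _ xs)
        (sumℤ-map-cong (λ x → cong sumℤ (sym (Listₚ.map-∘ (allVecs xs k)))) xs)

sumℤ-allVecs-∏ : ∀ {A : Set} (xs : List A) m (f : Fin m → A → ℤ) →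
  sumℤ (map (λ v → ∏ m (λ k → f k (lookup v k))) (allVecs xs m))
    ≡ ∏ m (λ k → sumℤ (map (f k) xs))
sumℤ-allVecs-∏ xs zero    f = refl
sumℤ-allVecs-∏ xs (suc m) f = begin
  sumℤ (map F (allVecs xs (suc m)))
    ≡⟨ sumℤ-allVecs-suc xs m F ⟩
  sumℤ (map (λ x → sumℤ (map (λ v → f fz x * F′ v) (allVecs xs m))) xs)
    ≡⟨ sumℤ-map-cong (λ x → sumℤ-map-*ˡ (f fz x) F′ (allVecs xs m)) xs ⟩
  sumℤ (map (λ x → f fz x * sumℤ (map F′ (allVecs xs m))) xs)
    ≡⟨ sumℤ-map-*ʳ _ (f fz) xs ⟩
  sumℤ (map (f fz) xs) * sumℤ (map F′ (allVecs xs m))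
    ≡⟨ cong (sumℤ (map (f fz) xs) *_) (sumℤ-allVecs-∏ xs m (f ∘ fs)) ⟩
  sumℤ (map (f fz) xs) * ∏ m (λ k → sumℤ (map (f (fs k)) xs)) ∎
  where
  F : Vec _ (suc m) → ℤ
  F v = ∏ (suc m) (λ k → f k (lookup v k))
  F′ : Vec _ m → ℤ
  F′ v = ∏ m (λ k → f (fs k) (lookup v k))

∑ℤ-0 : ∀ n → ∑ℤ n (λ _ → 0ℤ) ≡ 0ℤ
∑ℤ-0 zero    = refl
∑ℤ-0 (suc n) = trans (ℤP.+-identityˡ _) (∑ℤ-0 n)

∑ℤ-cong : ∀ n {f g : Fin n → ℤ} → (∀ i → f i ≡ g i) → ∑ℤ n f ≡ ∑ℤ n g
∑ℤ-cong zero    f≗g = refl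
∑ℤ-cong (suc n) f≗g = cong₂ _+_ (f≗g fz) (∑ℤ-cong n (f≗g ∘ fs))

-- _==_ is isYes ∘ _≟_, which does not compute under suc.
fs==fs : ∀ {n} (x y : Fin n) → (fs x == fs y) ≡ (x == y)
fs==fs x y with x ≟ y
... | yes _ = refl
... | no  _ = refl

∑ℤ-δ : ∀ {n} (a : Fin n) (f : Fin n → ℤ) → ∑ℤ n (λ x → 𝟙 (x == a) * f x) ≡ f a
∑ℤ-δ {suc n} fz     f =
  trans (cong₂ _+_ (ℤP.*-identityˡ (f fz)) (∑ℤ-0 n)) (ℤP.+-identityʳ (f fz))
∑ℤ-δ {suc n} (fs a) f = begin
  0ℤ + ∑ℤ n (λ x → 𝟙 (fs x == fs a) * f (fs x))
    ≡⟨ ℤP.+-identityˡ _ ⟩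
  ∑ℤ n (λ x → 𝟙 (fs x == fs a) * f (fs x))
    ≡⟨ ∑ℤ-cong n (λ x → cong (λ b → 𝟙 b * f (fs x)) (fs==fs x a)) ⟩
  ∑ℤ n (λ x → 𝟙 (x == a) * f (fs x))
    ≡⟨ ∑ℤ-δ a (f ∘ fs) ⟩
  f (fs a) ∎

sumℤ-allFin-δ : ∀ {n} (a : Fin n) (f : Fin n → ℤ) →
  sumℤ (map (λ x → 𝟙 (x == a) * f x) (allFin n)) ≡ f a
sumℤ-allFin-δ {n} a f = trans (sym (∑ℤ-tabulate n _ id)) (∑ℤ-δ a f)

∑² : ∀ {n} → (Fin n → Fin n → ℤ) → ℤ
∑² {n} F = sumℤ (map (λ x → sumℤ (map (F x) (allFin n))) (allFin n))

∑²-cong : ∀ {n} {F H : Fin n → Fin n → ℤ} → (∀ x y → F x y ≡ H x y) → ∑² F ≡ ∑² H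
∑²-cong {n} F≗H = sumℤ-map-cong (λ x → sumℤ-map-cong (F≗H x) (allFin n)) (allFin n)

∑²-+ : ∀ {n} (F H : Fin n → Fin n → ℤ) → ∑² (λ x y → F x y + H x y) ≡ ∑² F + ∑² H
∑²-+ {n} F H = trans (sumℤ-map-cong (λ x → sumℤ-map-+ (F x) (H x) (allFin n)) (allFin n))
                     (sumℤ-map-+ _ _ (allFin n))

∑²-δ : ∀ {n} (F : Fin n → Fin n → Bool) a b →
  ∑² (λ x y → 𝟙 (F x y ∧ (x == a ∧ y == b))) ≡ 𝟙 (F a b)
∑²-δ {n} F a b = begin
  ∑² (λ x y → 𝟙 (F x y ∧ (x == a ∧ y == b)))
    ≡⟨ ∑²-cong (λ x y → 𝟙-factor (F x y) (x == a) (y == b)) ⟩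
  ∑² (λ x y → 𝟙 (y == b) * (𝟙 (x == a) * 𝟙 (F x y)))
    ≡⟨ sumℤ-map-cong (λ x → sumℤ-allFin-δ b (λ y → 𝟙 (x == a) * 𝟙 (F x y))) (allFin n) ⟩
  sumℤ (map (λ x → 𝟙 (x == a) * 𝟙 (F x b)) (allFin n))
    ≡⟨ sumℤ-allFin-δ a (λ x → 𝟙 (F x b)) ⟩
  𝟙 (F a b) ∎
  where
  𝟙-factor : ∀ f x y → 𝟙 (f ∧ (x ∧ y)) ≡ 𝟙 y * (𝟙 x * 𝟙 f)
  𝟙-factor f x y = begin
    𝟙 (f ∧ (x ∧ y))       ≡⟨ 𝟙-∧ f (x ∧ y) ⟩
    𝟙 f * 𝟙 (x ∧ y)       ≡⟨ cong (𝟙 f *_) (𝟙-∧ x y) ⟩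
    𝟙 f * (𝟙 x * 𝟙 y)     ≡⟨ x*yz≡z*yx (𝟙 f) (𝟙 x) (𝟙 y) ⟩
    𝟙 y * (𝟙 x * 𝟙 f)     ∎

+count≡∑ℤ-𝟙 : ∀ k (c : Fin k → Bool) → + count k c ≡ ∑ℤ k (𝟙 ∘ c)
+count≡∑ℤ-𝟙 zero    c = refl
+count≡∑ℤ-𝟙 (suc k) c =
  trans (ℤP.pos-+ (if c fz then 1 else 0) _) (cong (_+_ (𝟙 (c fz))) (+count≡∑ℤ-𝟙 k (c ∘ fs)))

∏-const : ∀ m a → ∏ m (λ _ → + a) ≡ + (a ^ m)
∏-const zero    a = refl
∏-const (suc m) a = trans (cong (+ a *_) (∏-const m a)) (sym (ℤP.pos-* a (a ^ m)))

∏-if≡^count : ∀ d (c : Fin d → Bool) x → ∏ d (λ t → if c t then x else 1ℤ) ≡ x ^ℤ count d c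
∏-if≡^count zero    c x = refl
∏-if≡^count (suc d) c x with c fz
... | true  = cong (x *_) (∏-if≡^count d (c ∘ fs) x)
... | false = trans (ℤP.*-identityˡ _) (∏-if≡^count d (c ∘ fs) x)

∏-if-none : ∀ m (c : Fin m → Bool) (x : Fin m → ℤ) → count m c ≡ 0 →
  ∏ m (λ k → if c k then x k else 1ℤ) ≡ 1ℤ
∏-if-none zero    c x _ = refl
∏-if-none (suc m) c x h with c fz
... | false = trans (ℤP.*-identityˡ _) (∏-if-none m (c ∘ fs) (x ∘ fs) h)

∑ℤ-if≡𝟙*∏-if : ∀ m (c : Fin m → Bool) (x : Fin m → ℤ) b →
  count m c ≡ (if b then 1 else 0) →
  ∑ℤ m (λ k → if c k then x k else 0ℤ) ≡ 𝟙 b * ∏ m (λ k → if c k then x k else 1ℤ)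
∑ℤ-if≡𝟙*∏-if zero    c x false _ = refl
∑ℤ-if≡𝟙*∏-if (suc m) c x b h with c fz
∑ℤ-if≡𝟙*∏-if (suc m) c x b h | false =
  trans (ℤP.+-identityˡ _)
        (trans (∑ℤ-if≡𝟙*∏-if m (c ∘ fs) (x ∘ fs) b h) (cong (𝟙 b *_) (sym (ℤP.*-identityˡ _))))
∑ℤ-if≡𝟙*∏-if (suc m) c x true h | true = begin
  x fz + ∑ℤ m (λ k → if c (fs k) then x (fs k) else 0ℤ)
    ≡⟨ cong (_+_ (x fz)) (∑ℤ-if≡𝟙*∏-if m (c ∘ fs) (x ∘ fs) false none) ⟩
  x fz + 0ℤ
    ≡⟨ ℤP.+-identityʳ (x fz) ⟩
  x fz
    ≡⟨ sym (ℤP.*-identityʳ (x fz)) ⟩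
  x fz * 1ℤ
    ≡⟨ cong (x fz *_) (sym (∏-if-none m (c ∘ fs) (x ∘ fs) none)) ⟩
  x fz * ∏ m (λ k → if c (fs k) then x (fs k) else 1ℤ)
    ≡⟨ sym (ℤP.*-identityˡ _) ⟩
  1ℤ * (x fz * ∏ m (λ k → if c (fs k) then x (fs k) else 1ℤ)) ∎
  where
  none : count m (c ∘ fs) ≡ 0
  none = ℕP.suc-injective h

walkWeight : ∀ {n d} → Matrix n → Vec (Fin n) (suc d) → ℤ
walkWeight {d = d} A w = ∏ d (λ t → A (stepFrom w t) (stepTo w t))

closedWalkWeight : ∀ {n d} → Matrix n → Vec (Fin n) (suc d) → ℤ
closedWalkWeight {d = d} A w = 𝟙 (lookup w (fromℕ d) == head w) * walkWeight A w

^ᴹ≡sum-walks : ∀ {n} d (A : Matrix n) u v → (A ^ᴹ d) u v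
  ≡ sumℤ (map (λ w → 𝟙 (lookup (u ∷ w) (fromℕ d) == v) * walkWeight A (u ∷ w))
              (allVecs (allFin n) d))
^ᴹ≡sum-walks zero A u v with u == v
... | true  = refl
... | false = refl
^ᴹ≡sum-walks {n} (suc d) A u v = begin
  ∑ℤ n (λ x → A u x * (A ^ᴹ d) x v)
    ≡⟨ ∑ℤ-tabulate n (λ x → A u x * (A ^ᴹ d) x v) id ⟩
  sumℤ (map (λ x → A u x * (A ^ᴹ d) x v) (allFin n))
    ≡⟨ sumℤ-map-cong (λ x → cong (A u x *_) (^ᴹ≡sum-walks d A x v)) (allFin n) ⟩
  sumℤ (map (λ x → A u x * sumℤ (map (W x) Ws)) (allFin n))
    ≡⟨ sumℤ-map-cong (λ x → sym (sumℤ-map-*ˡ (A u x) (W x) Ws)) (allFin n) ⟩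
  sumℤ (map (λ x → sumℤ (map (λ w → A u x * W x w) Ws)) (allFin n))
    ≡⟨ sumℤ-map-cong (λ x → sumℤ-map-cong (λ w → x*yz≡y*xz (A u x) (ends x w) _) Ws) (allFin n) ⟩
  sumℤ (map (λ x → sumℤ (map (λ w → W′ (x ∷ w)) Ws)) (allFin n))
    ≡⟨ sym (sumℤ-allVecs-suc (allFin n) d W′) ⟩
  sumℤ (map W′ (allVecs (allFin n) (suc d))) ∎
  where
  Ws = allVecs (allFin n) d
  ends : Fin n → Vec (Fin n) d → ℤ
  ends x w = 𝟙 (lookup (x ∷ w) (fromℕ d) == v)
  W : Fin n → Vec (Fin n) d → ℤ
  W x w = ends x w * walkWeight A (x ∷ w)
  W′ : Vec (Fin n) (suc d) → ℤ
  W′ w = 𝟙 (lookup (u ∷ w) (fromℕ (suc d)) == v) * walkWeight A (u ∷ w)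

trace-^ᴹ≡sum-closedWalks : ∀ {n} d (A : Matrix n) →
  trace (A ^ᴹ d) ≡ sumℤ (map (closedWalkWeight A) (allVecs (allFin n) (suc d)))
trace-^ᴹ≡sum-closedWalks {n} d A = begin
  ∑ℤ n (λ u → (A ^ᴹ d) u u)
    ≡⟨ ∑ℤ-tabulate n (λ u → (A ^ᴹ d) u u) id ⟩
  sumℤ (map (λ u → (A ^ᴹ d) u u) (allFin n))
    ≡⟨ sumℤ-map-cong (λ u → ^ᴹ≡sum-walks d A u u) (allFin n) ⟩
  sumℤ (map (λ u → sumℤ (map (closedWalkWeight A ∘ (u ∷_)) Ws)) (allFin n))
    ≡⟨ sym (sumℤ-allVecs-suc (allFin n) d (closedWalkWeight A)) ⟩
  sumℤ (map (closedWalkWeight A) (allVecs (allFin n) (suc d))) ∎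
  where
  Ws = allVecs (allFin n) d

-1^-parity : ∀ e → (- 1ℤ) ^ℤ e ≡ (if isEven e then 1ℤ else - 1ℤ)
-1^-parity zero          = refl
-1^-parity (suc zero)    = refl
-1^-parity (suc (suc e)) = begin
  - 1ℤ * (- 1ℤ * (- 1ℤ) ^ℤ e) ≡⟨ ℤP.-1*i≡-i _ ⟩
  - (- 1ℤ * (- 1ℤ) ^ℤ e)      ≡⟨ cong -_ (ℤP.-1*i≡-i _) ⟩
  - - ((- 1ℤ) ^ℤ e)           ≡⟨ ℤP.neg-involutive _ ⟩
  (- 1ℤ) ^ℤ e                 ≡⟨ -1^-parity e ⟩
  (if isEven e then 1ℤ else - 1ℤ) ∎

sum-sign-^ : ∀ e → sumℤ (map (λ s → sign s ^ℤ e) (true ∷ false ∷ [])) ≡ + 2 * 𝟙 (isEven e)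
sum-sign-^ e rewrite ℤP.^-zeroˡ e | -1^-parity e with isEven e
... | true  = refl
... | false = refl

sum-signFunctions-∏ : ∀ m (e : Fin m → ℕ) →
  sumℤ (map (λ π → ∏ m (λ k → sign (lookup π k) ^ℤ e k)) (allVecs (true ∷ false ∷ []) m))
    ≡ + (2 ^ m) * ∏ m (λ k → 𝟙 (isEven (e k)))
sum-signFunctions-∏ m e = begin
  sumℤ (map (λ π → ∏ m (λ k → sign (lookup π k) ^ℤ e k)) (allVecs (true ∷ false ∷ []) m))
    ≡⟨ sumℤ-allVecs-∏ (true ∷ false ∷ []) m (λ k s → sign s ^ℤ e k) ⟩
  ∏ m (λ k → sumℤ (map (λ s → sign s ^ℤ e k) (true ∷ false ∷ [])))
    ≡⟨ ∏-cong (sum-sign-^ ∘ e) ⟩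
  ∏ m (λ k → + 2 * 𝟙 (isEven (e k)))
    ≡⟨ ∏-distrib-* (λ _ → + 2) (𝟙 ∘ isEven ∘ e) ⟩
  ∏ m (λ _ → + 2) * ∏ m (λ k → 𝟙 (isEven (e k)))
    ≡⟨ cong (_* ∏ m (λ k → 𝟙 (isEven (e k)))) (∏-const m 2) ⟩
  + (2 ^ m) * ∏ m (λ k → 𝟙 (isEven (e k))) ∎

pairs-disjoint : ∀ {n} {u v : Fin n} → u ≢ v → ∀ x y →
  (x == u ∧ y == v) ∧ (x == v ∧ y == u) ≡ false
pairs-disjoint {u = u} {v} u≢v x y with x ≟ u | x ≟ v
... | no _     | _        = refl
... | yes _    | no _     = ∧-zeroʳ (y == v)
... | yes refl | yes refl = ⊥-elim (u≢v refl)

module _ {n} (G : SimpleGraph n) where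

  arc : Fin n → Fin n → Bool
  arc x y = adj G x y ∧ (toℕ x <ᵇ toℕ y)

  ∑ℤ-edges : ∀ (f : Fin n × Fin n → ℤ) →
    ∑ℤ (numEdges G) (f ∘ edgeAt G) ≡ ∑² (λ x y → 𝟙 (arc x y) * f (x , y))
  ∑ℤ-edges f = begin
    ∑ℤ (numEdges G) (f ∘ edgeAt G)
      ≡⟨ ∑ℤ-lookup f (edges G) ⟩
    sumℤ (map f (edges G))
      ≡⟨ sumℤ-map-concatMap f (λ x → map (x ,_) (out x)) (allFin n) ⟩
    sumℤ (map (λ x → sumℤ (map f (map (x ,_) (out x)))) (allFin n))
      ≡⟨ sumℤ-map-cong (λ x → trans (cong sumℤ (sym (Listₚ.map-∘ (out x))))
                                    (sumℤ-map-filter (arc x) (f ∘ (x ,_)) (allFin n))) (allFin n) ⟩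
    ∑² (λ x y → 𝟙 (arc x y) * f (x , y)) ∎
    where
    out : Fin n → List (Fin n)
    out x = filter (T? ∘ arc x) (allFin n)

  𝟙-arc+𝟙-arc : ∀ {u v} → u ≢ v → 𝟙 (arc u v) + 𝟙 (arc v u) ≡ 𝟙 (adj G u v)
  𝟙-arc+𝟙-arc {u} {v} u≢v rewrite adj-sym G v u with adj G u v
  ... | true  = 𝟙<ᵇ+𝟙>ᵇ≡1 (u≢v ∘ toℕ-injective)
  ... | false = refl

  ∑ℤ-𝟙-sameEdge : ∀ u v →
    ∑ℤ (numEdges G) (λ k → 𝟙 (sameEdge (edgeAt G k) u v)) ≡ 𝟙 (adj G u v)
  ∑ℤ-𝟙-sameEdge u v with u ≟ v
  ... | yes refl = begin
    ∑ℤ (numEdges G) (λ k → 𝟙 (sameEdge (edgeAt G k) u u))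
      ≡⟨ ∑ℤ-edges (λ e → 𝟙 (sameEdge e u u)) ⟩
    ∑² (λ x y → 𝟙 (arc x y) * 𝟙 (sameEdge (x , y) u u))
      ≡⟨ ∑²-cong (λ x y → trans (sym (𝟙-∧ (arc x y) _))
                                (cong (λ b → 𝟙 (arc x y ∧ b)) (∨-idem _))) ⟩
    ∑² (λ x y → 𝟙 (arc x y ∧ (x == u ∧ y == u)))
      ≡⟨ ∑²-δ arc u u ⟩
    𝟙 (adj G u u ∧ (toℕ u <ᵇ toℕ u))
      ≡⟨ cong (λ b → 𝟙 (b ∧ _)) (adj-irr G u) ⟩
    0ℤ
      ≡⟨ cong 𝟙 (sym (adj-irr G u)) ⟩
    𝟙 (adj G u u) ∎
  ... | no u≢v = begin
    ∑ℤ (numEdges G) (λ k → 𝟙 (sameEdge (edgeAt G k) u v))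
      ≡⟨ ∑ℤ-edges (λ e → 𝟙 (sameEdge e u v)) ⟩
    ∑² (λ x y → 𝟙 (arc x y) * 𝟙 (sameEdge (x , y) u v))
      ≡⟨ ∑²-cong (λ x y → 𝟙-∧-∨-disjoint (arc x y) _ _ (pairs-disjoint u≢v x y)) ⟩
    ∑² (λ x y → 𝟙 (arc x y ∧ (x == u ∧ y == v)) + 𝟙 (arc x y ∧ (x == v ∧ y == u)))
      ≡⟨ ∑²-+ (λ x y → 𝟙 (arc x y ∧ (x == u ∧ y == v)))
              (λ x y → 𝟙 (arc x y ∧ (x == v ∧ y == u))) ⟩
    ∑² (λ x y → 𝟙 (arc x y ∧ (x == u ∧ y == v)))
      + ∑² (λ x y → 𝟙 (arc x y ∧ (x == v ∧ y == u)))
      ≡⟨ cong₂ _+_ (∑²-δ arc u v) (∑²-δ arc v u) ⟩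
    𝟙 (arc u v) + 𝟙 (arc v u)
      ≡⟨ 𝟙-arc+𝟙-arc u≢v ⟩
    𝟙 (adj G u v) ∎

  count-sameEdge : ∀ u v →
    count (numEdges G) (λ k → sameEdge (edgeAt G k) u v) ≡ (if adj G u v then 1 else 0)
  count-sameEdge u v =
    ℤP.+-injective (trans (+count≡∑ℤ-𝟙 (numEdges G) _) (∑ℤ-𝟙-sameEdge u v))

  signedAdj≡𝟙*∏ : ∀ π u v → signedAdj G π u v
    ≡ 𝟙 (adj G u v)
      * ∏ (numEdges G) (λ k → if sameEdge (edgeAt G k) u v then sign (lookup π k) else 1ℤ)
  signedAdj≡𝟙*∏ π u v =
    ∑ℤ-if≡𝟙*∏-if (numEdges G) _ (sign ∘ lookup π) (adj G u v) (count-sameEdge u v)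

  walkWeight-signedAdj : ∀ {d} π (w : Vec (Fin n) (suc d)) → walkWeight (signedAdj G π) w
    ≡ ∏ d (λ t → 𝟙 (adj G (stepFrom w t) (stepTo w t)))
      * ∏ (numEdges G) (λ k → sign (lookup π k) ^ℤ usage w (edgeAt G k))
  walkWeight-signedAdj {d} π w = begin
    ∏ d (λ t → signedAdj G π (stepFrom w t) (stepTo w t))
      ≡⟨ ∏-cong (λ t → signedAdj≡𝟙*∏ π (stepFrom w t) (stepTo w t)) ⟩
    ∏ d (λ t → α t * ∏ m (λ k → σ k t))
      ≡⟨ ∏-distrib-* α (λ t → ∏ m (λ k → σ k t)) ⟩
    ∏ d α * ∏ d (λ t → ∏ m (λ k → σ k t))
      ≡⟨ cong (∏ d α *_) (∏-comm (λ t k → σ k t)) ⟩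
    ∏ d α * ∏ m (λ k → ∏ d (σ k))
      ≡⟨ cong (∏ d α *_) (∏-cong (λ k → ∏-if≡^count d (uses k) (sign (lookup π k)))) ⟩
    ∏ d α * ∏ m (λ k → sign (lookup π k) ^ℤ usage w (edgeAt G k)) ∎
    where
    m = numEdges G
    α : Fin d → ℤ
    α t = 𝟙 (adj G (stepFrom w t) (stepTo w t))
    uses : Fin m → Fin d → Bool
    uses k t = sameEdge (edgeAt G k) (stepFrom w t) (stepTo w t)
    σ : Fin m → Fin d → ℤ
    σ k t = if uses k t then sign (lookup π k) else 1ℤ

  𝟙-parityClosedWalk : ∀ d (w : Vec (Fin n) (suc d)) →
    𝟙 (isClosedWalk G d w ∧ isParityClosed G d w)
      ≡ 𝟙 (lookup w (fromℕ d) == head w) * ∏ d (λ t → 𝟙 (adj G (stepFrom w t) (stepTo w t)))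
        * ∏ (numEdges G) (λ k → 𝟙 (isEven (usage w (edgeAt G k))))
  𝟙-parityClosedWalk d w =
    trans (𝟙-∧ (isClosedWalk G d w) _)
          (cong₂ _*_ (trans (𝟙-∧ closes _) (cong (𝟙 closes *_) (𝟙-allB-tabulate d step id)))
                     (𝟙-allB-lookup (λ e → isEven (usage w e)) (edges G)))
    where
    closes : Bool
    closes = lookup w (fromℕ d) == head w
    step : Fin d → Bool
    step t = adj G (stepFrom w t) (stepTo w t)

  sum-signFunctions-closedWalkWeight : ∀ d (w : Vec (Fin n) (suc d)) →
    sumℤ (map (λ π → closedWalkWeight (signedAdj G π) w) (allSignFunctions G))
      ≡ + (2 ^ numEdges G) * 𝟙 (isClosedWalk G d w ∧ isParityClosed G d w)
  sum-signFunctions-closedWalkWeight d w = begin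
    sumℤ (map (λ π → c * walkWeight (signedAdj G π) w) Π)
      ≡⟨ sumℤ-map-cong (λ π → trans (cong (c *_) (walkWeight-signedAdj π w))
                                    (sym (ℤP.*-assoc c a (S π)))) Π ⟩
    sumℤ (map (λ π → (c * a) * S π) Π)
      ≡⟨ sumℤ-map-*ˡ (c * a) S Π ⟩
    (c * a) * sumℤ (map S Π)
      ≡⟨ cong ((c * a) *_) (sum-signFunctions-∏ m (λ k → usage w (edgeAt G k))) ⟩
    (c * a) * (+ (2 ^ m) * p)
      ≡⟨ x*yz≡y*xz (c * a) (+ (2 ^ m)) p ⟩
    + (2 ^ m) * ((c * a) * p)
      ≡⟨ cong (+ (2 ^ m) *_) (sym (𝟙-parityClosedWalk d w)) ⟩
    + (2 ^ m) * 𝟙 (isClosedWalk G d w ∧ isParityClosed G d w) ∎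
    where
    m = numEdges G
    Π = allSignFunctions G
    c = 𝟙 (lookup w (fromℕ d) == head w)
    a = ∏ d (λ t → 𝟙 (adj G (stepFrom w t) (stepTo w t)))
    p = ∏ m (λ k → 𝟙 (isEven (usage w (edgeAt G k))))
    S : SignFunction G → ℤ
    S π = ∏ m (λ k → sign (lookup π k) ^ℤ usage w (edgeAt G k))

theorem3p1 : (n : ℕ) (G : SimpleGraph n) (d : ℕ) →
    + (2 ^ numEdges G) * + parityClosedWalkCount G d
      ≡ sumℤ (map (λ π → spectralMoment G π d) (allSignFunctions G))
theorem3p1 n G d = begin
  + (2 ^ m) * + parityClosedWalkCount G d
    ≡⟨ cong (+ (2 ^ m) *_) (+length-filter parityClosed walks) ⟩
  + (2 ^ m) * sumℤ (map (𝟙 ∘ parityClosed) walks)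
    ≡⟨ sym (sumℤ-map-*ˡ (+ (2 ^ m)) (𝟙 ∘ parityClosed) walks) ⟩
  sumℤ (map (λ w → + (2 ^ m) * 𝟙 (parityClosed w)) walks)
    ≡⟨ sym (sumℤ-map-cong (sum-signFunctions-closedWalkWeight G d) walks) ⟩
  sumℤ (map (λ w → sumℤ (map (λ π → closedWalkWeight (signedAdj G π) w) Π)) walks)
    ≡⟨ sumℤ-map-comm (λ w π → closedWalkWeight (signedAdj G π) w) walks Π ⟩
  sumℤ (map (λ π → sumℤ (map (closedWalkWeight (signedAdj G π)) walks)) Π)
    ≡⟨ sym (sumℤ-map-cong (λ π → trace-^ᴹ≡sum-closedWalks d (signedAdj G π)) Π) ⟩
  sumℤ (map (λ π → spectralMoment G π d) Π) ∎
  where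
  m = numEdges G
  Π = allSignFunctions G
  walks = allVecs (allFin n) (suc d)
  parityClosed : Vec (Fin n) (suc d) → Bool
  parityClosed w = isClosedWalk G d w ∧ isParityClosed G d w
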